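{- For all $r \in \mathbb{C}$, \[ e^{y\frac{d}{dx}}\big(\ell_{1}(x)^{r}\big)=\sum_{m \geq 0}\sum_{n=0}^{m}\binom{r}{n}\frac{n!}{m!}(-1)^{m-n}S_1(m,n)\left(\frac{y}{\ell_{0}(x)}\right)^{m}\ell_{1}(x)^{r-n}, \] where the integers $S_1(m,n)$, $0\le n\le m$, are defined by the recurrence $S_1(m,n)=(m-1)S_1(m-1,n)+S_1(m-1,n-1)$ for $1 \leq n < m$, with boundary conditions $S_1(m,0)=0$ for $m>0$ and $S_1(m,m)=1$ for $m\ge0$.
   Context: Let $\ell_{n}(x)$, $n \in \mathbb{Z}$, be commuting formal variables and let $\mathbb{C}\{[\ell]\}$ be the commutative algebra with basis all monomials $\prod_{i}\ell_{i}(x)^{r_{i}}$, $r_i\in\mathbb{C}$, almost all zero, multiplication adding exponents. Let $\frac{d}{dx}$ be the unique derivation with $\frac{d}{dx}\ell_{0}(x)^{r}=r\ell_{0}(x)^{r-1}$ and, for $n>0$, $\frac{d}{dx}\ell_{n}(x)^{r}=r\ell_{n}(x)^{r-1}\prod_{i=0}^{n-1}\ell_{i}(x)^{ -1}$, $\frac{d}{dx}\ell_{ -n}(x)^{r}=r\ell_{ -n}(x)^{r-1}\prod_{i=1}^{n}\ell_{ -i}(x)$. $y$ is a formal variable and $e^{y\frac{d}{dx}}=\sum_{k\ge0}\frac{y^k}{k!}(\frac{d}{dx})^k$. $\binom{r}{n}=r(r-1)\cdots(r-n+1)/n!$. -}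

module Defs where

open import Level using (Level; _⊔_)
open import Algebra.Bundles using (CommutativeRing)
open import Data.Nat as ℕ using (ℕ; zero; suc; _∸_; _!)
open import Data.Integer as ℤ using (ℤ; +_; -[1+_])
open import Data.Product using (_×_; _,_)
open import Data.List using (List; []; _∷_; [_]; _++_; map; concatMap; upTo)
open import Relation.Nullary using (¬_; yes; no)
open import Relation.Binary.Construct.Closure.Equivalence using (EqClosure)

-- Unsigned Stirling numbers of the first kind S₁(m,n), via the recurrence of
-- the paper: S₁(m,n) = (m-1) S₁(m-1,n) + S₁(m-1,n-1), S₁(m,0)=0 (m>0),
-- S₁(m,m)=1; (values with n > m are 0 and never used in the statement).
S₁ : ℕ → ℕ → ℕ
S₁ zero    zero    = 1
S₁ zero    (suc n) = 0
S₁ (suc m) zero    = 0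
S₁ (suc m) (suc n) = m ℕ.* S₁ m (suc n) ℕ.+ S₁ m n

module Cast {c ℓ} (R : CommutativeRing c ℓ) where
  open CommutativeRing R
  cast : ℕ → Carrier
  cast zero    = 0#
  cast (suc n) = 1# + cast n

record CharZeroField (c ℓ : Level) : Set (Level.suc (c ⊔ ℓ)) where
  field
    commRing : CommutativeRing c ℓ
  open CommutativeRing commRing
  open Cast commRing
  field
    inv      : (x : Carrier) → ¬ (x ≈ 0#) → Carrier
    inv-law  : (x : Carrier) (p : ¬ (x ≈ 0#)) → x * inv x p ≈ 1#
    charZero : (n : ℕ) → ¬ (cast (suc n) ≈ 0#)

module Alg {c ℓ} (F : CharZeroField c ℓ) where
  open CharZeroField F public
  open CommutativeRing commRing public renaming (Carrier to K)
  open Cast commRing public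

  recipSuc : ℕ → K
  recipSuc n = inv (cast (suc n)) (charZero n)

  invFact : ℕ → K
  invFact zero    = 1#
  invFact (suc n) = recipSuc n * invFact n

  pow : K → ℕ → K
  pow x zero    = 1#
  pow x (suc n) = x * pow x n

  falling : K → ℕ → K
  falling r zero    = 1#
  falling r (suc n) = falling r n * (r - cast n)

  binom : K → ℕ → K
  binom r n = falling r n * invFact n

  -- The algebra ℂ{[ℓ]} (with K in place of ℂ).
  -- A monomial ∏ ℓ_i^{r_i} is represented by a finite list of factors (i , r);
  -- its exponent of ℓ_i is the sum of the r's attached to i.
  Mono : Set c
  Mono = List (ℤ × K)

  expo : Mono → ℤ → K
  expo []            j = 0#
  expo ((i , r) ∷ m) j with i ℤ.≟ j
  ... | yes _ = r + expo m j
  ... | no  _ = expo m j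

  -- equality of monomials (multiplication = concatenation of factor lists)
  _≈ₘ_ : Mono → Mono → Set ℓ
  m ≈ₘ m' = ∀ j → expo m j ≈ expo m' j

  Elt : Set c
  Elt = List (K × Mono)

  -- one-step identifications generating the free K-module on monomials
  data _⟶_ : Elt → Elt → Set (c ⊔ ℓ) where
    swap  : ∀ a b t → (a ∷ b ∷ t) ⟶ (b ∷ a ∷ t)
    merge : ∀ x x' m m' t → m ≈ₘ m' → ((x , m) ∷ (x' , m') ∷ t) ⟶ ((x + x' , m) ∷ t)
    drop0 : ∀ x m t → x ≈ 0# → ((x , m) ∷ t) ⟶ t
    coef  : ∀ x x' m t → x ≈ x' → ((x , m) ∷ t) ⟶ ((x' , m) ∷ t)
    there : ∀ a {s t} → s ⟶ t → (a ∷ s) ⟶ (a ∷ t)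

  _∼_ : Elt → Elt → Set (c ⊔ ℓ)
  _∼_ = EqClosure _⟶_

  scale : K → Elt → Elt
  scale k = map (λ { (x , m) → (k * x , m) })

  mono : K → Mono → Elt
  mono x m = [ x , m ]

  -- d/dx ℓ_n = (∏_{i=0}^{n-1} ℓ_i^{-1}) for n>0, ℓ_{-n} ↦ ∏_{i=1}^{n} ℓ_{-i};
  -- extraFactor i is the monomial by which d/dx ℓ_i^r differs from r ℓ_i^{r-1}.
  extraFactor : ℤ → Mono
  extraFactor (+ zero)  = []
  extraFactor (+ suc n) = map (λ i → (+ i , - 1#)) (upTo (suc n))
  extraFactor -[1+ n ]  = map (λ i → (-[1+ i ] , 1#)) (upTo (suc n))

  dMono : Mono → Elt
  dMono []            = []
  dMono ((i , r) ∷ m) =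
    (r , (i , r - 1#) ∷ (extraFactor i ++ m))
      ∷ map (λ { (x , m') → (x , (i , r) ∷ m') }) (dMono m)

  d : Elt → Elt
  d = concatMap (λ { (x , m) → scale x (dMono m) })

  dPow : ℕ → Elt → Elt
  dPow zero    a = a
  dPow (suc k) a = d (dPow k a)

  -- Formal power series in y with coefficients in the algebra:
  -- a series is its sequence of y^k coefficients.
  Series : Set c
  Series = ℕ → Elt

  _≋_ : Series → Series → Set (c ⊔ ℓ)
  f ≋ g = ∀ k → f k ∼ g k

  expYD : Elt → Series
  expYD a k = scale (invFact k) (dPow k a)

  ell1^ : K → Elt
  ell1^ r = mono 1# [ (+ 1 , r) ]

  sumTo : ℕ → (ℕ → Elt) → Elt
  sumTo m f = concatMap f (upTo (suc m))

  rhs : K → Series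
  rhs r m = sumTo m (λ n →
    mono (binom r n * cast (n !) * invFact m * pow (- 1#) (m ∸ n) * cast (S₁ m n))
         ((+ 0 , - cast m) ∷ (+ 1 , r - cast n) ∷ []))

-- By induction on k,
--   (d/dx)^k ℓ₁^r = Σ_{n ≤ k} (r)ₙ (-1)^{k-n} S₁(k,n) ℓ₀^{-k} ℓ₁^{r-n},
-- where (r)ₙ is the falling factorial: differentiating ℓ₀^{-k} ℓ₁^{r-n} gives
-- -k ℓ₀^{-k-1} ℓ₁^{r-n} + (r-n) ℓ₀^{-k-1} ℓ₁^{r-n-1}, and collecting like terms the
-- coefficients obey exactly the recurrence of the signed Stirling numbers.  Dividing by k!
-- and writing (r)ₙ = n! (r choose n) gives the coefficient of y^k.
-- Since an element of the algebra is a list of terms modulo the identifications _⟶_, the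
-- induction needs d to respect them; on monomials this holds because
-- d m = Σ_{(i , r) ∈ m} r · m ℓᵢ⁻¹ (extraFactor i) depends on m only through its exponents.

module Submission where

open import Level using (Level)
open import Defs
open import Algebra.Bundles using (CommutativeRing)
import Algebra.Solver.CommutativeMonoid as CommutativeMonoidSolver
open import Data.Nat as ℕ using (ℕ; zero; suc; _∸_; _!; _≤_; _<_; z≤n; s≤s)
import Data.Nat.Properties as ℕ
open import Data.Integer as ℤ using (ℤ; +_)
open import Data.Product using (_×_; _,_)
open import Data.Sum using (inj₁; inj₂)
open import Data.List using (List; []; _∷_; [_]; _++_; map; concatMap; applyUpTo; length)
import Data.List.Properties as List
open import Data.List.Relation.Binary.Permutation.Propositional as Perm using (_↭_)
import Data.List.Relation.Binary.Permutation.Propositional.Properties as Perm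
open import Function using (_∘_)
open import Relation.Binary.PropositionalEquality as ≡ using (_≡_; _≢_)
open import Relation.Binary.Construct.Closure.ReflexiveTransitive using (ε; _◅_; _◅◅_)
open import Relation.Binary.Construct.Closure.Symmetric using (fwd)
import Relation.Binary.Construct.Closure.Equivalence as EqClosure
import Relation.Binary.Reasoning.Setoid
open import Relation.Nullary using (yes; no)
open import Relation.Nullary.Negation using (contradiction)

module CastProperties {c ℓ} (R : CommutativeRing c ℓ) where
  open CommutativeRing R
  open Cast R
  open import Algebra.Properties.Semiring.Mult semiring using (×-homo-+; ×1-homo-*) renaming (_×_ to _×′_)

  cast≡×1# : ∀ n → cast n ≡ n ×′ 1#
  cast≡×1# zero    = ≡.refl
  cast≡×1# (suc n) = ≡.cong (_+_ 1#) (cast≡×1# n)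

  cast-+ : ∀ m n → cast (m ℕ.+ n) ≈ cast m + cast n
  cast-+ m n rewrite cast≡×1# (m ℕ.+ n) | cast≡×1# m | cast≡×1# n = ×-homo-+ 1# m n

  cast-* : ∀ m n → cast (m ℕ.* n) ≈ cast m * cast n
  cast-* m n rewrite cast≡×1# (m ℕ.* n) | cast≡×1# m | cast≡×1# n = ×1-homo-* m n

module Proof {c ℓ} (F : CharZeroField c ℓ) where
  open Alg F
  open CastProperties commRing
  open import Algebra.Properties.Ring ring using (-0#≈0#; -‿+-comm; -1*x≈-x; -‿distribˡ-*; -‿distribʳ-*)
  module +-Solver = CommutativeMonoidSolver +-commutativeMonoid
  module *-Solver = CommutativeMonoidSolver *-commutativeMonoid
  module ≈-Reasoning = Relation.Binary.Reasoning.Setoid setoid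

  -- Monomials

  ≈ₘ-sym : ∀ {m m'} → m ≈ₘ m' → m' ≈ₘ m
  ≈ₘ-sym p j = sym (p j)

  expo-++ : ∀ m m' j → expo (m ++ m') j ≈ expo m j + expo m' j
  expo-++ []            m' j = sym (+-identityˡ _)
  expo-++ ((i , r) ∷ m) m' j with i ℤ.≟ j
  ... | yes _ = trans (+-congˡ (expo-++ m m' j)) (sym (+-assoc _ _ _))
  ... | no  _ = expo-++ m m' j

  expo-head : ∀ i r m → expo ((i , r) ∷ m) i ≈ r + expo m i
  expo-head i r m with i ℤ.≟ i
  ... | yes _  = refl
  ... | no i≢i = contradiction ≡.refl i≢i

  expo-there : ∀ {i j} r m → i ≢ j → expo ((i , r) ∷ m) j ≈ expo m j
  expo-there {i} {j} r m i≢j with i ℤ.≟ j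
  ... | yes i≡j = contradiction i≡j i≢j
  ... | no  _   = refl

  expo-∷-cong : ∀ f m m' j → expo m j ≈ expo m' j → expo (f ∷ m) j ≈ expo (f ∷ m') j
  expo-∷-cong f m m' j eq = trans (expo-++ [ f ] m j) (trans (+-congˡ eq) (sym (expo-++ [ f ] m' j)))

  ∷-congₘ : ∀ f {m m'} → m ≈ₘ m' → (f ∷ m) ≈ₘ (f ∷ m')
  ∷-congₘ f {m} {m'} p j = expo-∷-cong f m m' j (p j)

  ++-congₘ : ∀ e {m m'} → m ≈ₘ m' → (e ++ m) ≈ₘ (e ++ m')
  ++-congₘ []      p = p
  ++-congₘ (f ∷ e) p = ∷-congₘ f (++-congₘ e p)

  exponent-cong : ∀ i {a b} m → a ≈ b → ((i , a) ∷ m) ≈ₘ ((i , b) ∷ m)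
  exponent-cong i m a≈b j with i ℤ.≟ j
  ... | yes _ = +-congʳ a≈b
  ... | no  _ = refl

  exponent-split : ∀ i a b m → ((i , a + b) ∷ m) ≈ₘ ((i , a) ∷ (i , b) ∷ m)
  exponent-split i a b m j with i ℤ.≟ j
  ... | yes ≡.refl = trans (+-assoc a b _) (+-congˡ (sym (expo-head i b m)))
  ... | no  i≢j    = sym (expo-there b m i≢j)

  zero-exponent : ∀ i {a} m → a ≈ 0# → ((i , a) ∷ m) ≈ₘ m
  zero-exponent i m a≈0 j with i ℤ.≟ j
  ... | yes _ = trans (+-congʳ a≈0) (+-identityˡ _)
  ... | no  _ = refl

  ↭⇒≈ₘ : ∀ {m m'} → m ↭ m' → m ≈ₘ m'
  ↭⇒≈ₘ Perm.refl                    _ = refl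
  ↭⇒≈ₘ (Perm.prep {xs} {ys} f p)       = ∷-congₘ f {xs} {ys} (↭⇒≈ₘ p)
  ↭⇒≈ₘ (Perm.trans p q)              j = trans (↭⇒≈ₘ p j) (↭⇒≈ₘ q j)
  ↭⇒≈ₘ (Perm.swap {xs} {ys} (i , a) (i' , b) p) j = begin
    expo ((i , a) ∷ (i' , b) ∷ xs) j          ≈⟨ trans (expo-++ [ i , a ] _ j) (+-congˡ (expo-++ [ i' , b ] xs j)) ⟩
    A + (B + expo xs j)                       ≈⟨ +-Solver.solve 3 (λ x y z → x ⊕ (y ⊕ z) ⊜ y ⊕ (x ⊕ z)) refl A B _ ⟩
    B + (A + expo xs j)                       ≈⟨ +-congˡ (+-congˡ (↭⇒≈ₘ p j)) ⟩
    B + (A + expo ys j)                       ≈⟨ sym (trans (expo-++ [ i' , b ] _ j) (+-congˡ (expo-++ [ i , a ] ys j))) ⟩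
    expo ((i' , b) ∷ (i , a) ∷ ys) j          ∎
    where
      open ≈-Reasoning
      open +-Solver using (_⊕_; _⊜_)
      A = expo [ i , a ] j
      B = expo [ i' , b ] j

  -- Formal sums modulo ∼

  module ∼-Reasoning = Relation.Binary.Reasoning.Setoid (EqClosure.setoid _⟶_)

  ⟶⇒∼ : ∀ {s t} → s ⟶ t → s ∼ t
  ⟶⇒∼ s⟶t = fwd s⟶t ◅ ε

  ∼-sym : ∀ {s t} → s ∼ t → t ∼ s
  ∼-sym = EqClosure.symmetric _⟶_

  ∼-lift : (G : Elt → Elt) → (∀ {s t} → s ⟶ t → G s ∼ G t) → ∀ {s t} → s ∼ t → G s ∼ G t
  ∼-lift G = EqClosure.gfold (EqClosure.isEquivalence _⟶_) G

  ∷-cong : ∀ a {s t} → s ∼ t → (a ∷ s) ∼ (a ∷ t)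
  ∷-cong a = EqClosure.gmap (a ∷_) (there a)

  ++-congˡ : ∀ u {s t} → s ∼ t → (u ++ s) ∼ (u ++ t)
  ++-congˡ []      s∼t = s∼t
  ++-congˡ (a ∷ u) s∼t = ∷-cong a (++-congˡ u s∼t)

  ++-congʳ : ∀ u {s t} → s ∼ t → (s ++ u) ∼ (t ++ u)
  ++-congʳ u = EqClosure.gmap (_++ u) step
    where
      step : ∀ {s t} → s ⟶ t → (s ++ u) ⟶ (t ++ u)
      step (swap a b t)          = swap a b (t ++ u)
      step (merge x x' m m' t p) = merge x x' m m' (t ++ u) p
      step (drop0 x m t p)       = drop0 x m (t ++ u) p
      step (coef x x' m t p)     = coef x x' m (t ++ u) p
      step (there a s⟶t)         = there a (step s⟶t)

  ↭⇒∼ : ∀ {s t} → s ↭ t → s ∼ t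
  ↭⇒∼ Perm.refl          = ε
  ↭⇒∼ (Perm.prep a p)    = ∷-cong a (↭⇒∼ p)
  ↭⇒∼ (Perm.swap a b p)  = ⟶⇒∼ (swap a b _) ◅◅ ∷-cong b (∷-cong a (↭⇒∼ p))
  ↭⇒∼ (Perm.trans p q)   = ↭⇒∼ p ◅◅ ↭⇒∼ q

  -- Insert the term 0·m' and merge x·m into it.
  term-cong : ∀ {x x' m m'} t → x ≈ x' → m ≈ₘ m' → ((x , m) ∷ t) ∼ ((x' , m') ∷ t)
  term-cong {x} {x'} {m} {m'} t x≈x' m≈m' =
    ∼-sym (⟶⇒∼ (drop0 0# m' _ refl))
    ◅◅ ⟶⇒∼ (merge 0# x m' m t (≈ₘ-sym {m} {m'} m≈m'))
    ◅◅ ⟶⇒∼ (coef _ x' m' t (trans (+-identityˡ x) x≈x'))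

  scale-congʳ : ∀ k {s t} → s ∼ t → scale k s ∼ scale k t
  scale-congʳ k = ∼-lift (scale k) step
    where
      step : ∀ {s t} → s ⟶ t → scale k s ∼ scale k t
      step (swap _ _ t)          = ⟶⇒∼ (swap _ _ _)
      step (merge x x' m m' t p) = ⟶⇒∼ (merge _ _ m m' _ p) ◅◅ ⟶⇒∼ (coef _ _ m _ (sym (distribˡ k x x')))
      step (drop0 x m t p)       = ⟶⇒∼ (drop0 _ m _ (trans (*-congˡ p) (zeroʳ k)))
      step (coef x x' m t p)     = ⟶⇒∼ (coef _ _ m _ (*-congˡ p))
      step (there _ s⟶t)         = ∷-cong _ (step s⟶t)

  scale-congˡ : ∀ {x x'} u → x ≈ x' → scale x u ∼ scale x' u
  scale-congˡ []            x≈x' = ε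
  scale-congˡ ((y , m) ∷ u) x≈x' = ⟶⇒∼ (coef _ _ m _ (*-congʳ x≈x')) ◅◅ ∷-cong _ (scale-congˡ u x≈x')

  scale-+ : ∀ x x' u t → (scale x u ++ (scale x' u ++ t)) ∼ (scale (x + x') u ++ t)
  scale-+ x x' []            t = ε
  scale-+ x x' ((y , m) ∷ u) t =
    ∷-cong _ (↭⇒∼ (Perm.shift (x' * y , m) (scale x u) (scale x' u ++ t)))
    ◅◅ ⟶⇒∼ (merge _ _ m m _ (λ _ → refl))
    ◅◅ ⟶⇒∼ (coef _ _ m _ (sym (distribʳ y x x')))
    ◅◅ ∷-cong _ (scale-+ x x' u t)

  scale-zero : ∀ {x} u t → x ≈ 0# → (scale x u ++ t) ∼ t
  scale-zero []            t x≈0 = ε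
  scale-zero ((y , m) ∷ u) t x≈0 =
    ⟶⇒∼ (drop0 _ m _ (trans (*-congʳ x≈0) (zeroˡ y))) ◅◅ scale-zero u t x≈0

  -- d is well defined

  prefix : ℤ × K → K × Mono → K × Mono
  prefix f (x , m) = (x , f ∷ m)

  map-prefix-cong : ∀ f {s t} → s ∼ t → map (prefix f) s ∼ map (prefix f) t
  map-prefix-cong f = EqClosure.gmap (map (prefix f)) step
    where
      step : ∀ {s t} → s ⟶ t → map (prefix f) s ⟶ map (prefix f) t
      step (swap _ _ _)          = swap _ _ _
      step (merge x x' m m' t p) = merge _ _ _ _ _ (∷-congₘ f {m} {m'} p)
      step (drop0 x m t p)       = drop0 _ _ _ p
      step (coef x x' m t p)     = coef _ _ _ _ p
      step (there _ s⟶t)         = there _ (step s⟶t)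

  expSum : (ℤ → Mono) → Mono → Elt
  expSum f = map (λ { (i , r) → (r , f i) })

  expSum-cong : ∀ {f g} m → (∀ i → f i ≈ₘ g i) → expSum f m ∼ expSum g m
  expSum-cong []            f≈g = ε
  expSum-cong ((i , r) ∷ m) f≈g = term-cong _ refl (f≈g i) ◅◅ ∷-cong _ (expSum-cong m f≈g)

  prefix-expSum : ∀ f {g h} m → (∀ i → (f ∷ g i) ≈ₘ h i) → map (prefix f) (expSum g m) ∼ expSum h m
  prefix-expSum f []            _  = ε
  prefix-expSum f ((i , r) ∷ m) eq = term-cong _ refl (eq i) ◅◅ ∷-cong _ (prefix-expSum f m eq)

  dropIndex : ℤ → Mono → Mono
  dropIndex j []            = []
  dropIndex j ((i , r) ∷ m) with i ℤ.≟ j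
  ... | yes _ = dropIndex j m
  ... | no  _ = (i , r) ∷ dropIndex j m

  length-dropIndex : ∀ j m → length (dropIndex j m) ≤ length m
  length-dropIndex j []            = z≤n
  length-dropIndex j ((i , r) ∷ m) with i ℤ.≟ j
  ... | yes _ = ℕ.m≤n⇒m≤1+n (length-dropIndex j m)
  ... | no  _ = s≤s (length-dropIndex j m)

  expo-dropIndex-≡ : ∀ j m → expo (dropIndex j m) j ≈ 0#
  expo-dropIndex-≡ j []            = refl
  expo-dropIndex-≡ j ((i , r) ∷ m) with i ℤ.≟ j
  ... | yes _   = expo-dropIndex-≡ j m
  ... | no  i≢j = trans (expo-there r (dropIndex j m) i≢j) (expo-dropIndex-≡ j m)

  expo-dropIndex-≢ : ∀ {j k} m → j ≢ k → expo (dropIndex j m) k ≈ expo m k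
  expo-dropIndex-≢ []            j≢k = refl
  expo-dropIndex-≢ {j} {k} ((i , r) ∷ m) j≢k with i ℤ.≟ j
  ... | yes ≡.refl = trans (expo-dropIndex-≢ m j≢k) (sym (expo-there r m j≢k))
  ... | no  _      = expo-∷-cong (i , r) (dropIndex j m) m k (expo-dropIndex-≢ m j≢k)

  expSum-split : ∀ f j m → expSum f m ∼ ((expo m j , f j) ∷ expSum f (dropIndex j m))
  expSum-split f j []            = ∼-sym (⟶⇒∼ (drop0 0# (f j) [] refl))
  expSum-split f j ((i , r) ∷ m) with i ℤ.≟ j
  ... | yes ≡.refl = ∷-cong _ (expSum-split f i m) ◅◅ ⟶⇒∼ (merge _ _ _ _ _ (λ _ → refl))
  ... | no  _      = ∷-cong _ (expSum-split f j m) ◅◅ ⟶⇒∼ (swap _ _ _)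

  Null : Mono → Set ℓ
  Null m = ∀ j → expo m j ≈ 0#

  -- Merge the terms of index i (total coefficient expo m i ≈ 0) and recurse on the rest.
  expSum-null : ∀ f m → Null m → expSum f m ∼ []
  expSum-null f m = go (length m) m ℕ.≤-refl
    where
      go : ∀ n m → length m ≤ n → Null m → expSum f m ∼ []
      go _       []            _           _    = ε
      go (suc n) ((i , r) ∷ m) (s≤s |m|≤n) null =
        ∷-cong _ (expSum-split f i m)
        ◅◅ ⟶⇒∼ (merge _ _ _ _ _ (λ _ → refl))
        ◅◅ ⟶⇒∼ (drop0 _ _ _ (trans (sym (expo-head i r m)) (null i)))
        ◅◅ go n (dropIndex i m) (ℕ.≤-trans (length-dropIndex i m) |m|≤n) null′
        where
          null′ : Null (dropIndex i m)
          null′ j with i ℤ.≟ j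
          ... | yes ≡.refl = expo-dropIndex-≡ i m
          ... | no  i≢j    = trans (expo-dropIndex-≢ m i≢j) (trans (sym (expo-there r m i≢j)) (null j))

  negate : Mono → Mono
  negate = map (λ { (i , r) → (i , - r) })

  expo-negate : ∀ m j → expo (negate m) j ≈ - expo m j
  expo-negate []            j = sym -0#≈0#
  expo-negate ((i , r) ∷ m) j with i ℤ.≟ j
  ... | yes _ = trans (+-congˡ (expo-negate m j)) (-‿+-comm r _)
  ... | no  _ = expo-negate m j

  expSum-resp : ∀ f {m m'} → m ≈ₘ m' → expSum f m ∼ expSum f m'
  expSum-resp f {m} {m'} m≈m' = begin
    expSum f m                                          ≡⟨ List.++-identityʳ _ ⟨
    expSum f m ++ []                                    ≈⟨ ++-congˡ (expSum f m) (∼-sym (expSum-null f (negate m' ++ m') cancelˡ)) ⟩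
    expSum f m ++ expSum f (negate m' ++ m')            ≡⟨ ≡.cong (expSum f m ++_) (List.map-++ _ (negate m') m') ⟩
    expSum f m ++ (expSum f (negate m') ++ expSum f m') ≡⟨ List.++-assoc (expSum f m) _ _ ⟨
    (expSum f m ++ expSum f (negate m')) ++ expSum f m' ≡⟨ ≡.cong (_++ expSum f m') (List.map-++ _ m (negate m')) ⟨
    expSum f (m ++ negate m') ++ expSum f m'            ≈⟨ ++-congʳ (expSum f m') (expSum-null f (m ++ negate m') cancelʳ) ⟩
    expSum f m'                                         ∎
    where
      open ∼-Reasoning
      cancelˡ : Null (negate m' ++ m')
      cancelˡ j = trans (expo-++ (negate m') m' j) (trans (+-congʳ (expo-negate m' j)) (-‿inverseˡ _))
      cancelʳ : Null (m ++ negate m')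
      cancelʳ j = trans (expo-++ m (negate m') j) (trans (+-cong (m≈m' j) (expo-negate m' j)) (-‿inverseʳ _))

  dFactor : Mono → ℤ → Mono
  dFactor m i = (i , - 1#) ∷ (extraFactor i ++ m)

  dMono-expSum : ∀ m → dMono m ∼ expSum (dFactor m) m
  dMono-expSum []            = ε
  dMono-expSum ((i , r) ∷ m) =
    term-cong _ refl head
    ◅◅ ∷-cong _ (map-prefix-cong (i , r) (dMono-expSum m) ◅◅ prefix-expSum (i , r) m tail)
    where
      E = extraFactor
      head : ((i , r - 1#) ∷ (E i ++ m)) ≈ₘ dFactor ((i , r) ∷ m) i
      head j = trans (exponent-cong i (E i ++ m) (+-comm r (- 1#)) j)
        (trans (exponent-split i (- 1#) r (E i ++ m) j)
               (↭⇒≈ₘ (Perm.prep (i , - 1#) (Perm.↭-sym (Perm.shift (i , r) (E i) m))) j))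
      tail : ∀ i' → ((i , r) ∷ dFactor m i') ≈ₘ dFactor ((i , r) ∷ m) i'
      tail i' = ↭⇒≈ₘ (Perm.trans (Perm.swap (i , r) (i' , - 1#) Perm.refl)
                                 (Perm.prep (i' , - 1#) (Perm.↭-sym (Perm.shift (i , r) (E i') m))))

  dMono-cong : ∀ {m m'} → m ≈ₘ m' → dMono m ∼ dMono m'
  dMono-cong {m} {m'} m≈m' =
    dMono-expSum m
    ◅◅ expSum-cong m (λ i → ∷-congₘ (i , - 1#) {extraFactor i ++ m} {extraFactor i ++ m'}
                                     (++-congₘ (extraFactor i) {m} {m'} m≈m'))
    ◅◅ expSum-resp (dFactor m') m≈m'
    ◅◅ ∼-sym (dMono-expSum m')

  d-cong : ∀ {s t} → s ∼ t → d s ∼ d t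
  d-cong = ∼-lift d step
    where
      step : ∀ {s t} → s ⟶ t → d s ∼ d t
      step (swap (x , m) (x' , m') t) = ↭⇒∼ (Perm.shifts (scale x (dMono m)) (scale x' (dMono m')))
      step (merge x x' m m' t m≈m')   =
        ++-congˡ (scale x (dMono m)) (++-congʳ (d t) (scale-congʳ x' (dMono-cong {m'} {m} (≈ₘ-sym {m} {m'} m≈m'))))
        ◅◅ scale-+ x x' (dMono m) (d t)
      step (drop0 x m t x≈0)          = scale-zero (dMono m) (d t) x≈0
      step (coef x x' m t x≈x')       = ++-congʳ (d t) (scale-congˡ (dMono m) x≈x')
      step (there (x , m) s⟶t)        = ++-congˡ (scale x (dMono m)) (step s⟶t)

  sumUpTo : ℕ → (ℕ → Elt) → Elt
  sumUpTo zero    f = []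
  sumUpTo (suc N) f = f 0 ++ sumUpTo N (f ∘ suc)

  concatMap-applyUpTo : ∀ (f : ℕ → Elt) g N → concatMap f (applyUpTo g N) ≡ sumUpTo N (f ∘ g)
  concatMap-applyUpTo f g zero    = ≡.refl
  concatMap-applyUpTo f g (suc N) = ≡.cong (f (g 0) ++_) (concatMap-applyUpTo f (g ∘ suc) N)

  sumUpTo-cong : ∀ N {f g} → (∀ n → f n ∼ g n) → sumUpTo N f ∼ sumUpTo N g
  sumUpTo-cong zero    _   = ε
  sumUpTo-cong (suc N) {f} {g} f∼g = ++-congʳ _ (f∼g 0) ◅◅ ++-congˡ (g 0) (sumUpTo-cong N (f∼g ∘ suc))

  d-sumUpTo : ∀ N f → d (sumUpTo N f) ≡ sumUpTo N (d ∘ f)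
  d-sumUpTo zero    f = ≡.refl
  d-sumUpTo (suc N) f = ≡.trans (List.concatMap-++ _ (f 0) _) (≡.cong (d (f 0) ++_) (d-sumUpTo N (f ∘ suc)))

  scale-sumUpTo : ∀ k N f → scale k (sumUpTo N f) ≡ sumUpTo N (scale k ∘ f)
  scale-sumUpTo k zero    f = ≡.refl
  scale-sumUpTo k (suc N) f = ≡.trans (List.map-++ _ (f 0) _) (≡.cong (scale k (f 0) ++_) (scale-sumUpTo k N (f ∘ suc)))

  plusShift : (ℕ → K) → (ℕ → K) → ℕ → K
  plusShift u v zero    = u 0
  plusShift u v (suc n) = v n + u (suc n)

  collect-shifted : ∀ N u v (e : ℕ → Mono) → u N ≈ 0# →
    sumUpTo N (λ n → (u n , e n) ∷ (v n , e (suc n)) ∷ []) ∼ sumUpTo (suc N) (λ n → mono (plusShift u v n) (e n))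
  collect-shifted zero    u v e uN≈0 = ∼-sym (⟶⇒∼ (drop0 _ _ [] uN≈0))
  collect-shifted (suc N) u v e uN≈0 =
    ∷-cong _ (∷-cong _ (collect-shifted N (u ∘ suc) (v ∘ suc) (e ∘ suc) uN≈0))
    ◅◅ ∷-cong _ (⟶⇒∼ (merge _ _ _ _ _ (λ _ → refl)))

  -- Signed Stirling numbers of the first kind

  S₁-above : ∀ {k n} → k < n → S₁ k n ≡ 0
  S₁-above {zero}  {suc n} _         = ≡.refl
  S₁-above {suc k} {suc n} (s≤s k<n)
    rewrite S₁-above k<n | S₁-above (ℕ.m≤n⇒m≤1+n k<n) = ≡.trans (ℕ.+-identityʳ (k ℕ.* 0)) (ℕ.*-zeroʳ k)

  signedStirling : ℕ → ℕ → K
  signedStirling k n = pow (- 1#) (k ∸ n) * cast (S₁ k n)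

  signedStirling-above : ∀ {k n} → k < n → signedStirling k n ≈ 0#
  signedStirling-above {k} {n} k<n rewrite S₁-above k<n = zeroʳ _

  sign-flip : ∀ {k n} → n < k → pow (- 1#) (k ∸ n) ≈ - pow (- 1#) (k ∸ suc n)
  sign-flip {suc k} (s≤s n≤k) rewrite ℕ.+-∸-assoc 1 n≤k = -1*x≈-x _

  signedStirling-step : ∀ k n → pow (- 1#) (k ∸ n) * (cast k * cast (S₁ k (suc n))) ≈ signedStirling k (suc n) * - cast k
  signedStirling-step k n with ℕ.≤-<-connex k n
  ... | inj₁ k≤n rewrite S₁-above (s≤s k≤n) =
    trans (*-congˡ (zeroʳ _)) (trans (zeroʳ _) (sym (trans (*-congʳ (zeroʳ _)) (zeroˡ _))))
  ... | inj₂ n<k = begin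
    π * (cast k * S)        ≈⟨ *-congʳ (sign-flip n<k) ⟩
    - π′ * (cast k * S)     ≈⟨ -‿distribˡ-* π′ _ ⟨
    - (π′ * (cast k * S))   ≈⟨ -‿cong (*-Solver.solve 3 (λ a b c → a ⊕ (b ⊕ c) ⊜ (a ⊕ c) ⊕ b) refl π′ (cast k) S) ⟩
    - ((π′ * S) * cast k)   ≈⟨ -‿distribʳ-* _ _ ⟩
    (π′ * S) * - cast k     ∎
    where
      open ≈-Reasoning
      open *-Solver using (_⊕_; _⊜_)
      π = pow (- 1#) (k ∸ n)
      π′ = pow (- 1#) (k ∸ suc n)
      S = cast (S₁ k (suc n))

  signedStirling-suc : ∀ k n → signedStirling (suc k) (suc n) ≈ signedStirling k n + signedStirling k (suc n) * - cast k
  signedStirling-suc k n = begin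
    π * cast (k ℕ.* S₁ k (suc n) ℕ.+ S₁ k n)                 ≈⟨ *-congˡ (trans (cast-+ (k ℕ.* S₁ k (suc n)) (S₁ k n)) (+-congʳ (cast-* k (S₁ k (suc n))))) ⟩
    π * (cast k * cast (S₁ k (suc n)) + cast (S₁ k n))       ≈⟨ distribˡ π _ _ ⟩
    π * (cast k * cast (S₁ k (suc n))) + signedStirling k n  ≈⟨ +-comm _ _ ⟩
    signedStirling k n + π * (cast k * cast (S₁ k (suc n)))  ≈⟨ +-congˡ (signedStirling-step k n) ⟩
    signedStirling k n + signedStirling k (suc n) * - cast k ∎
    where
      open ≈-Reasoning
      π = pow (- 1#) (k ∸ n)

  signedStirling-zero : ∀ k → signedStirling (suc k) 0 ≈ signedStirling k 0 * - cast k
  signedStirling-zero zero    = trans (zeroʳ _) (sym (trans (*-congˡ -0#≈0#) (zeroʳ _)))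
  signedStirling-zero (suc k) = trans (zeroʳ _) (sym (trans (*-congʳ (zeroʳ _)) (zeroˡ _)))

  invFact-inverse : ∀ n → invFact n * cast (n !) ≈ 1#
  invFact-inverse zero    = trans (*-identityˡ _) (+-identityʳ 1#)
  invFact-inverse (suc n) = begin
    (recipSuc n * invFact n) * cast (suc n ℕ.* n !)            ≈⟨ *-congˡ (cast-* (suc n) (n !)) ⟩
    (recipSuc n * invFact n) * (cast (suc n) * cast (n !))     ≈⟨ *-Solver.solve 4 (λ a b c e → (a ⊕ b) ⊕ (c ⊕ e) ⊜ (c ⊕ a) ⊕ (b ⊕ e)) refl _ _ _ _ ⟩
    (cast (suc n) * recipSuc n) * (invFact n * cast (n !))     ≈⟨ *-cong (inv-law _ (charZero n)) (invFact-inverse n) ⟩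
    1# * 1#                                                    ≈⟨ *-identityˡ 1# ⟩
    1#                                                         ∎
    where
      open ≈-Reasoning
      open *-Solver using (_⊕_; _⊜_)

  neg-suc : ∀ n → - cast n - 1# ≈ - cast (suc n)
  neg-suc n = trans (+-comm _ _) (-‿+-comm 1# (cast n))

  sub-suc : ∀ x n → x - cast n - 1# ≈ x - cast (suc n)
  sub-suc x n = trans (+-assoc _ _ _) (+-congˡ (neg-suc n))

  -- The derivatives of ℓ₁^r

  module _ (r : K) where

    stirlingCoeff : ℕ → ℕ → K
    stirlingCoeff k n = falling r n * signedStirling k n

    derivCoeff : ℕ → (ℕ → K) → ℕ → K
    derivCoeff k a = plusShift (λ n → a n * - cast k) (λ n → a n * (r - cast n))

    stirlingCoeff-suc : ∀ k n → stirlingCoeff (suc k) n ≈ derivCoeff k (stirlingCoeff k) n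
    stirlingCoeff-suc k zero    = trans (*-identityˡ _) (trans (signedStirling-zero k) (*-congʳ (sym (*-identityˡ _))))
    stirlingCoeff-suc k (suc n) = begin
      (f * R) * signedStirling (suc k) (suc n) ≈⟨ *-congˡ (signedStirling-suc k n) ⟩
      (f * R) * (σ + τ * κ)                    ≈⟨ distribˡ _ _ _ ⟩
      (f * R) * σ + (f * R) * (τ * κ)          ≈⟨ +-cong (*-Solver.solve 3 (λ a b c → (a ⊕ b) ⊕ c ⊜ (a ⊕ c) ⊕ b) refl f R σ)
                                                         (sym (*-assoc _ _ _)) ⟩
      (f * σ) * R + ((f * R) * τ) * κ          ∎
      where
        open ≈-Reasoning
        open *-Solver using (_⊕_; _⊜_)
        f = falling r n
        R = r - cast n
        σ = signedStirling k n
        τ = signedStirling k (suc n)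
        κ = - cast k

    stirlingCoeff-above : ∀ k → stirlingCoeff k (suc k) ≈ 0#
    stirlingCoeff-above k = trans (*-congˡ (signedStirling-above (ℕ.n<1+n k))) (zeroʳ _)

    basis : ℕ → ℕ → Mono
    basis k n = (+ 0 , - cast k) ∷ (+ 1 , r - cast n) ∷ []

    expansion : ℕ → (ℕ → K) → Elt
    expansion k a = sumUpTo (suc k) (λ n → mono (a n) (basis k n))

    expansion-cong : ∀ k {a b} → (∀ n → a n ≈ b n) → expansion k a ∼ expansion k b
    expansion-cong k a≈b = sumUpTo-cong (suc k) (λ n → term-cong {m = basis k n} {m' = basis k n} [] (a≈b n) (λ _ → refl))

    d-basis : ∀ x k n →
      d (mono x (basis k n)) ∼ ((x * - cast k , basis (suc k) n) ∷ (x * (r - cast n) , basis (suc k) (suc n)) ∷ [])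
    d-basis x k n = term-cong _ refl (exponent-cong (+ 0) _ (neg-suc k)) ◅◅ ∷-cong _ (term-cong [] refl ℓ₁-step)
      where
        ℓ₁-step : ((+ 0 , - cast k) ∷ (+ 1 , r - cast n - 1#) ∷ (+ 0 , - 1#) ∷ []) ≈ₘ basis (suc k) (suc n)
        ℓ₁-step j = begin
          expo ((+ 0 , - cast k) ∷ (+ 1 , r - cast n - 1#) ∷ (+ 0 , - 1#) ∷ []) j
            ≈⟨ ↭⇒≈ₘ (Perm.shift (+ 0 , - 1#) ((+ 0 , - cast k) ∷ (+ 1 , r - cast n - 1#) ∷ []) []) j ⟩
          expo ((+ 0 , - 1#) ∷ (+ 0 , - cast k) ∷ (+ 1 , r - cast n - 1#) ∷ []) j
            ≈⟨ exponent-split (+ 0) (- 1#) (- cast k) _ j ⟨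
          expo ((+ 0 , - 1# - cast k) ∷ (+ 1 , r - cast n - 1#) ∷ []) j
            ≈⟨ exponent-cong (+ 0) _ (-‿+-comm 1# (cast k)) j ⟩
          expo ((+ 0 , - cast (suc k)) ∷ (+ 1 , r - cast n - 1#) ∷ []) j
            ≈⟨ expo-∷-cong (+ 0 , - cast (suc k)) _ _ j (exponent-cong (+ 1) [] (sub-suc r n) j) ⟩
          expo (basis (suc k) (suc n)) j
            ∎
          where open ≈-Reasoning

    d-expansion : ∀ k a → a (suc k) ≈ 0# → d (expansion k a) ∼ expansion (suc k) (derivCoeff k a)
    d-expansion k a a₊≈0 = begin
      d (expansion k a)                                               ≡⟨ d-sumUpTo (suc k) (λ n → mono (a n) (basis k n)) ⟩
      sumUpTo (suc k) (λ n → d (mono (a n) (basis k n)))              ≈⟨ sumUpTo-cong (suc k) (λ n → d-basis (a n) k n) ⟩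
      sumUpTo (suc k) (λ n → (a n * - cast k , basis (suc k) n) ∷ (a n * (r - cast n) , basis (suc k) (suc n)) ∷ [])
        ≈⟨ collect-shifted (suc k) (λ n → a n * - cast k) (λ n → a n * (r - cast n)) (basis (suc k)) (trans (*-congʳ a₊≈0) (zeroˡ _)) ⟩
      expansion (suc k) (derivCoeff k a)                              ∎
      where open ∼-Reasoning

    dPow-ell1^ : ∀ k → dPow k (ell1^ r) ∼ expansion k (stirlingCoeff k)
    dPow-ell1^ zero    = term-cong [] coeff monomial
      where
        coeff : 1# ≈ 1# * (1# * (1# + 0#))
        coeff = sym (trans (*-identityˡ _) (trans (*-identityˡ _) (+-identityʳ 1#)))
        monomial : ((+ 1 , r) ∷ []) ≈ₘ basis 0 0
        monomial j = sym (trans (zero-exponent (+ 0) _ -0#≈0# j)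
                                (exponent-cong (+ 1) [] (trans (+-congˡ -0#≈0#) (+-identityʳ r)) j))
    dPow-ell1^ (suc k) =
      d-cong (dPow-ell1^ k)
      ◅◅ d-expansion k (stirlingCoeff k) (stirlingCoeff-above k)
      ◅◅ expansion-cong (suc k) (λ n → sym (stirlingCoeff-suc k n))

    rhs-coefficient : ∀ k n →
      invFact k * stirlingCoeff k n ≈ binom r n * cast (n !) * invFact k * pow (- 1#) (k ∸ n) * cast (S₁ k n)
    rhs-coefficient k n = sym (begin
      falling r n * invFact n * cast (n !) * invFact k * pow (- 1#) (k ∸ n) * cast (S₁ k n)
        ≈⟨ *-Solver.solve 6 (λ f i! n! iK π s → ((((f ⊕ i!) ⊕ n!) ⊕ iK) ⊕ π) ⊕ s ⊜ (i! ⊕ n!) ⊕ (iK ⊕ (f ⊕ (π ⊕ s)))) refl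
             (falling r n) (invFact n) (cast (n !)) (invFact k) (pow (- 1#) (k ∸ n)) (cast (S₁ k n)) ⟩
      (invFact n * cast (n !)) * (invFact k * stirlingCoeff k n)
        ≈⟨ *-congʳ (invFact-inverse n) ⟩
      1# * (invFact k * stirlingCoeff k n)
        ≈⟨ *-identityˡ _ ⟩
      invFact k * stirlingCoeff k n ∎)
      where
        open ≈-Reasoning
        open *-Solver using (_⊕_; _⊜_)

    theorem : expYD (ell1^ r) ≋ rhs r
    theorem k = begin
      scale (invFact k) (dPow k (ell1^ r))              ≈⟨ scale-congʳ (invFact k) (dPow-ell1^ k) ⟩
      scale (invFact k) (expansion k (stirlingCoeff k)) ≡⟨ scale-sumUpTo (invFact k) (suc k) (λ n → mono (stirlingCoeff k n) (basis k n)) ⟩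
      expansion k (λ n → invFact k * stirlingCoeff k n) ≈⟨ expansion-cong k (rhs-coefficient k) ⟩
      expansion k (λ n → binom r n * cast (n !) * invFact k * pow (- 1#) (k ∸ n) * cast (S₁ k n))
                                                        ≡⟨ concatMap-applyUpTo (λ n → mono (binom r n * cast (n !) * invFact k * pow (- 1#) (k ∸ n) * cast (S₁ k n)) (basis k n)) (λ n → n) (suc k) ⟨
      rhs r k                                           ∎
      where open ∼-Reasoning

mainTheorem11 : ∀ {c ℓ : Level} (F : CharZeroField c ℓ) →
    let open Alg F in
    (r : K) → expYD (ell1^ r) ≋ rhs r
mainTheorem11 F = Proof.theorem F
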